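{- Let $a,b,r,s$ be nonzero real numbers. For every non-negative integer $i$, \[ \phi^{a,b}_{i}(x)=\left(\frac{a}{r}\right)^i \sum_{m=0}^{\lfloor i/2\rfloor}c_{i-2m}\,(-s)^m\binom{i}{m}\ {}_2F_1\!\left(-m,\,m-i;\,-i;\,\frac{b\,r^2}{a^2 s}\right)\psi^{r,s}_{i-2m}(x). \]
   Context: For nonzero reals $a,b$, the generalized Fibonacci polynomials are defined by $\phi^{a,b}_0(x)=1$, $\phi^{a,b}_1(x)=ax$, $\phi^{a,b}_j(x)=ax\,\phi^{a,b}_{j-1}(x)+b\,\phi^{a,b}_{j-2}(x)$ for $j\ge2$. For nonzero reals $r,s$, the generalized Lucas polynomials are defined by $\psi^{r,s}_0(x)=2$, $\psi^{r,s}_1(x)=rx$, $\psi^{r,s}_j(x)=rx\,\psi^{r,s}_{j-1}(x)+s\,\psi^{r,s}_{j-2}(x)$ for $j\ge2$. The constants are $c_0=\tfrac12$ and $c_j=1$ for $j\ge1$. For a non-negative integer $m$, ${}_2F_1(-m,\beta;\gamma;z)=\sum_{k=0}^{m}\frac{(-m)_k(\beta)_k}{(\gamma)_k}\frac{z^k}{k!}$, where $(u)_k=u(u+1)\cdots(u+k-1)$, $(u)_0=1$ (here $(\gamma)_k\ne0$ for all $0\le k\le m$). -}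

module Defs where

open import Level using (0ℓ)
open import Data.Nat as ℕ using (ℕ; zero; suc)
open import Data.Nat.Combinatorics using (_C_)
open import Data.Sum using (_⊎_)
open import Data.Product using (∃; _×_)
open import Relation.Binary.PropositionalEquality using (_≡_; _≢_)
open import Relation.Binary.Structures using (IsStrictTotalOrder)
open import Algebra.Structures using (IsCommutativeRing)

-- We axiomatise them as a
-- complete ordered field (Dedekind-complete: every nonempty predicate that is
-- bounded above has a least upper bound).
record RealField : Set₁ where
  infixl 6 _+_
  infixl 7 _*_
  infix  4 _<_ _≤_
  field
    Carrier : Set
    _+_ _*_ : Carrier → Carrier → Carrier
    -_      : Carrier → Carrier
    0# 1#   : Carrier
    _⁻¹     : Carrier → Carrier
    _<_     : Carrier → Carrier → Set
    isCommutativeRing : IsCommutativeRing _≡_ _+_ _*_ -_ 0# 1#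
    0≢1     : 0# ≢ 1#
    ⁻¹-inverse : ∀ x → x ≢ 0# → x * (x ⁻¹) ≡ 1#
    <-isStrictTotalOrder : IsStrictTotalOrder _≡_ _<_
    +-mono-< : ∀ {x y} z → x < y → x + z < y + z
    *-pos    : ∀ {x y} → 0# < x → 0# < y → 0# < x * y

  _≤_ : Carrier → Carrier → Set
  x ≤ y = (x < y) ⊎ (x ≡ y)

  field
    complete : (P : Carrier → Set) → ∃ P → ∃ (λ u → ∀ y → P y → y ≤ u) →
               ∃ (λ l → (∀ y → P y → y ≤ l) × (∀ u → (∀ y → P y → y ≤ u) → l ≤ u))

module Poly (R : RealField) where
  open RealField R

  _/_ : Carrier → Carrier → Carrier
  x / y = x * (y ⁻¹)

  fromℕ : ℕ → Carrier
  fromℕ zero    = 0#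
  fromℕ (suc n) = 1# + fromℕ n

  _^_ : Carrier → ℕ → Carrier
  x ^ zero  = 1#
  x ^ suc n = x * (x ^ n)

  sumTo : ℕ → (ℕ → Carrier) → Carrier
  sumTo zero    f = f 0
  sumTo (suc n) f = sumTo n f + f (suc n)

  poch : Carrier → ℕ → Carrier
  poch u zero    = 1#
  poch u (suc k) = poch u k * (u + fromℕ k)

  φ : Carrier → Carrier → ℕ → Carrier → Carrier
  φ a b zero          x = 1#
  φ a b (suc zero)    x = a * x
  φ a b (suc (suc j)) x = a * x * φ a b (suc j) x + b * φ a b j x

  ψ : Carrier → Carrier → ℕ → Carrier → Carrier
  ψ r s zero          x = 1# + 1#
  ψ r s (suc zero)    x = r * x
  ψ r s (suc (suc j)) x = r * x * ψ r s (suc j) x + s * ψ r s j x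

  c : ℕ → Carrier
  c zero    = 1# / (1# + 1#)
  c (suc j) = 1#

  hyp2F1 : ℕ → Carrier → Carrier → Carrier → Carrier
  hyp2F1 m β γ z =
    sumTo m (λ k → ((poch (- fromℕ m) k * poch β k) / poch γ k) * ((z ^ k) / fromℕ (k ℕ.!)))

-- Expanding the Fibonacci recurrence gives φ_i = Σ_k C(i−k,k) b^k (ax)^(i−2k). With α = a/r, y = rx
-- and z = b r²/(a² s) one has ax = αy and b = α² (−s)(−z), so φ_i = α^i Σ_k C(i−k,k) ((−s)(−z))^k y^(i−2k).
-- Each power of y is re-expanded in Lucas polynomials, y^n = Σ_j c_(n−2j) (−s)^j C(n,j) ψ_(n−2j), by induction
-- on n from ψ_(d+1) = y ψ_d + s ψ_(d−1). Collecting the double sum along m = k + j, the coefficient of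
-- c_(i−2m) (−s)^m ψ_(i−2m) is Σ_k C(i−k,k) C(i−2k,m−k) (−z)^k. Since (−m)_k = (−1)^k m↓k, the factorial
-- identity m↓k (i−m)↓k C(i,m) = C(i−k,k) C(i−2k,m−k) i↓k k! identifies it with C(i,m) ₂F₁(−m, m−i; −i; z).

module Submission where

open import Defs
open import Data.Nat as ℕ using (ℕ; _∸_)
open import Data.Nat.Combinatorics using (_C_)
open import Relation.Binary.PropositionalEquality using (_≡_; _≢_; sym; cong; cong₂; module ≡-Reasoning)

module Halving where

  open import Data.Nat using (ℕ; zero; suc; _+_; _*_; _∸_; _≤_; _<_; s≤s; _/_; _%_)
  open import Data.Nat.Properties
  open import Data.Nat.DivMod using (m≡m%n+[m/n]*n; m%n<n)
  open import Relation.Binary.PropositionalEquality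

  data FloorHalf : ℕ → ℕ → Set where
    even : ∀ h → FloorHalf (2 * h) h
    odd  : ∀ h → FloorHalf (suc (2 * h)) h

  floorHalf-/2 : ∀ n → FloorHalf n (n / 2)
  floorHalf-/2 n with n % 2 | m%n<n n 2 | m≡m%n+[m/n]*n n 2
  ... | 0 | _ | n≡ = subst (λ m → FloorHalf m (n / 2)) (sym (trans n≡ (*-comm (n / 2) 2))) (even (n / 2))
  ... | 1 | _ | n≡ = subst (λ m → FloorHalf m (n / 2)) (sym (trans n≡ (cong suc (*-comm (n / 2) 2)))) (odd (n / 2))
  ... | suc (suc _) | s≤s (s≤s ()) | _

  floorHalf⇒2h≤n : ∀ {n h} → FloorHalf n h → 2 * h ≤ n
  floorHalf⇒2h≤n (even h) = ≤-refl
  floorHalf⇒2h≤n (odd h)  = n≤1+n _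

  floorHalf⇒h≤n : ∀ {n h} → FloorHalf n h → h ≤ n
  floorHalf⇒h≤n {h = h} half = ≤-trans (m≤m+n h (h + 0)) (floorHalf⇒2h≤n half)

  floorHalf⇒n<2k : ∀ {n h k} → FloorHalf n h → h < k → n < 2 * k
  floorHalf⇒n<2k (even h) h<k = *-monoʳ-< 2 h<k
  floorHalf⇒n<2k {k = k} (odd h) h<k = subst (_≤ 2 * k) (*-suc 2 h) (*-monoʳ-≤ 2 h<k)

  floorHalf-∸ : ∀ {n h} k → k ≤ h → FloorHalf n h → FloorHalf (n ∸ 2 * k) (h ∸ k)
  floorHalf-∸ k _ (even h) = subst (λ m → FloorHalf m (h ∸ k)) (*-distribˡ-∸ 2 h k) (even (h ∸ k))
  floorHalf-∸ k k≤h (odd h) =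
    subst (λ m → FloorHalf m (h ∸ k)) (sym (trans (+-∸-assoc 1 (*-monoʳ-≤ 2 k≤h)) (cong suc (sym (*-distribˡ-∸ 2 h k)))))
          (odd (h ∸ k))

module Binomial where

  open import Data.Nat using (ℕ; zero; suc; _+_; _*_; _∸_; _≤_; _<_; s≤s; _!; ≢-nonZero⁻¹)
  open import Data.Nat.Properties
  open import Data.Nat.Combinatorics
  open import Data.Nat.DivMod using (m/n*n≡m)
  open import Data.Nat.Divisibility using (m≤n⇒m!∣n!)
  open import Data.Nat.Solver using (module +-*-Solver)
  open import Relation.Nullary using (yes; no)
  open import Relation.Binary.PropositionalEquality

  -- n C (k − 1), taken to be 0 at k = 0 (where truncated subtraction would give n C 0 = 1)
  _C[_-1] : ℕ → ℕ → ℕ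
  n C[ zero -1]  = 0
  n C[ suc k -1] = n C k

  [1+n]Ck≡nCk+nC[k-1] : ∀ n k → suc n C k ≡ n C k + n C[ k -1]
  [1+n]Ck≡nCk+nC[k-1] n zero    = refl
  [1+n]Ck≡nCk+nC[k-1] n (suc k) = trans (sym (nCk+nC[k+1]≡[n+1]C[k+1] n k)) (+-comm (n C k) _)

  nCk*k!*[n∸k]!≡n! : ∀ {n k} → k ≤ n → (n C k) * (k ! * (n ∸ k) !) ≡ n !
  nCk*k!*[n∸k]!≡n! {n} {k} k≤n =
    trans (cong (_* (k ! * (n ∸ k) !)) (nCk≡n!/k![n-k]! k≤n)) (m/n*n≡m (k![n∸k]!∣n! k≤n))
    where instance _ = k !* (n ∸ k) !≢0

  nPk*[n∸k]!≡n! : ∀ {n k} → k ≤ n → (n P k) * (n ∸ k) ! ≡ n !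
  nPk*[n∸k]!≡n! {n} {k} k≤n =
    trans (cong (_* (n ∸ k) !) (nPk≡n!/[n∸k]! k≤n)) (m/n*n≡m (m≤n⇒m!∣n! (m∸n≤m n k)))
    where instance _ = (n ∸ k) !≢0

  [1+n]P[1+k]≡[1+n]*nPk : ∀ n k → suc n P suc k ≡ suc n * (n P k)
  [1+n]P[1+k]≡[1+n]*nPk n k with k ≤? n
  ... | yes k≤n = *-cancelʳ-≡ _ _ ((n ∸ k) !) (begin
    (suc n P suc k) * (n ∸ k) ! ≡⟨ nPk*[n∸k]!≡n! (s≤s k≤n) ⟩
    suc n * n !                 ≡⟨ cong (suc n *_) (nPk*[n∸k]!≡n! k≤n) ⟨
    suc n * ((n P k) * (n ∸ k) !) ≡⟨ *-assoc (suc n) (n P k) ((n ∸ k) !) ⟨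
    suc n * (n P k) * (n ∸ k) ! ∎)
    where open ≡-Reasoning
          instance _ = (n ∸ k) !≢0
  ... | no k≰n = begin
    suc n P suc k ≡⟨ k>n⇒nPk≡0 (s≤s (≰⇒> k≰n)) ⟩
    0             ≡⟨ *-zeroʳ (suc n) ⟨
    suc n * 0     ≡⟨ cong (suc n *_) (k>n⇒nPk≡0 (≰⇒> k≰n)) ⟨
    suc n * (n P k) ∎
    where open ≡-Reasoning

  nPk≢0 : ∀ {n k} → k ≤ n → n P k ≢ 0
  nPk≢0 {n} {k} k≤n nPk≡0 = ≢-nonZero⁻¹ (n !) (begin
    n !               ≡⟨ nPk*[n∸k]!≡n! k≤n ⟨
    (n P k) * (n ∸ k) ! ≡⟨ cong (_* (n ∸ k) !) nPk≡0 ⟩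
    0                 ∎)
    where open ≡-Reasoning
          instance _ = n !≢0

  n<2k⇒[n∸k]Ck≡0 : ∀ {n} k → n < 2 * k → (n ∸ k) C k ≡ 0
  n<2k⇒[n∸k]Ck≡0 {n} (suc k) n<2k =
    k>n⇒nCk≡0 (m<n+o⇒m∸n<o n (suc k) (subst (n <_) (cong (suc k +_) (+-identityʳ (suc k))) n<2k))

  [1+2h]C[1+h]≡[1+2h]Ch : ∀ h → suc (2 * h) C suc h ≡ suc (2 * h) C h
  [1+2h]C[1+h]≡[1+2h]Ch h = begin
    suc (2 * h) C suc h         ≡⟨ cong (suc (2 * h) C_) [1+2h]∸h≡1+h ⟨
    suc (2 * h) C (suc (2 * h) ∸ h) ≡⟨ nCk≡nC[n∸k] h≤1+2h ⟨
    suc (2 * h) C h             ∎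
    where
      open ≡-Reasoning
      h≤1+2h : h ≤ suc (2 * h)
      h≤1+2h = m≤n⇒m≤1+n (m≤m+n h (h + 0))
      [1+2h]∸h≡1+h : suc (2 * h) ∸ h ≡ suc h
      [1+2h]∸h≡1+h = trans (+-∸-assoc 1 (m≤m+n h (h + 0))) (cong suc (trans (m+n∸m≡n h (h + 0)) (+-identityʳ h)))

  mPk*[i∸m]Pk*iCm≡[i∸k]Ck*[i∸2k]C[m∸k]*iPk*k! : ∀ {i m k} → k ≤ m → 2 * m ≤ i →
    (m P k) * ((i ∸ m) P k) * (i C m) ≡ ((i ∸ k) C k) * ((i ∸ 2 * k) C (m ∸ k)) * (i P k) * k !
  mPk*[i∸m]Pk*iCm≡[i∸k]Ck*[i∸2k]C[m∸k]*iPk*k! {i} {m} {k} k≤m 2m≤i =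
    *-cancelʳ-≡ _ _ ((m ∸ k) ! * (i ∸ m ∸ k) !) (trans lhs≡i! (sym rhs≡i!))
    where
      open ≡-Reasoning
      open +-*-Solver
      instance _ = (m ∸ k) !* (i ∸ m ∸ k) !≢0

      m≤i∸m : m ≤ i ∸ m
      m≤i∸m = m+n≤o⇒m≤o∸n m (subst (_≤ i) (cong (m +_) (+-identityʳ m)) 2m≤i)
      m≤i : m ≤ i
      m≤i = ≤-trans m≤i∸m (m∸n≤m i m)
      k≤i∸m : k ≤ i ∸ m
      k≤i∸m = ≤-trans k≤m m≤i∸m
      i∸k∸k≡i∸2k : i ∸ k ∸ k ≡ i ∸ 2 * k
      i∸k∸k≡i∸2k = trans (∸-+-assoc i k k) (cong (λ j → i ∸ (k + j)) (sym (+-identityʳ k)))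
      i∸m∸k≡i∸2k∸[m∸k] : i ∸ m ∸ k ≡ i ∸ 2 * k ∸ (m ∸ k)
      i∸m∸k≡i∸2k∸[m∸k] = begin
        i ∸ m ∸ k             ≡⟨ ∸-+-assoc i m k ⟩
        i ∸ (m + k)           ≡⟨ cong (λ j → i ∸ (j + k)) (m∸n+n≡m k≤m) ⟨
        i ∸ (m ∸ k + k + k)   ≡⟨ cong (i ∸_) (solve 2 (λ d k → d :+ k :+ k := k :+ (k :+ con 0) :+ d) refl (m ∸ k) k) ⟩
        i ∸ (2 * k + (m ∸ k)) ≡⟨ ∸-+-assoc i (2 * k) (m ∸ k) ⟨
        i ∸ 2 * k ∸ (m ∸ k)   ∎
      m∸k≤i∸2k : m ∸ k ≤ i ∸ 2 * k
      m∸k≤i∸2k = ≤-trans (subst (m ∸ k ≤_) i∸m∸k≡i∸2k∸[m∸k] (∸-monoˡ-≤ k m≤i∸m)) (m∸n≤m _ (m ∸ k))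
      k≤i∸k : k ≤ i ∸ k
      k≤i∸k = ≤-trans k≤i∸m (∸-monoʳ-≤ i k≤m)

      lhs≡i! : (m P k) * ((i ∸ m) P k) * (i C m) * ((m ∸ k) ! * (i ∸ m ∸ k) !) ≡ i !
      lhs≡i! = begin
        (m P k) * ((i ∸ m) P k) * (i C m) * ((m ∸ k) ! * (i ∸ m ∸ k) !)
          ≡⟨ solve 5 (λ a b c d e → a :* b :* c :* (d :* e) := c :* ((a :* d) :* (b :* e))) refl
               (m P k) ((i ∸ m) P k) (i C m) ((m ∸ k) !) ((i ∸ m ∸ k) !) ⟩
        (i C m) * (((m P k) * (m ∸ k) !) * (((i ∸ m) P k) * (i ∸ m ∸ k) !))
          ≡⟨ cong₂ (λ u v → (i C m) * (u * v)) (nPk*[n∸k]!≡n! k≤m) (nPk*[n∸k]!≡n! k≤i∸m) ⟩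
        (i C m) * (m ! * (i ∸ m) !)
          ≡⟨ nCk*k!*[n∸k]!≡n! m≤i ⟩
        i ! ∎

      rhs≡i! : ((i ∸ k) C k) * ((i ∸ 2 * k) C (m ∸ k)) * (i P k) * k ! * ((m ∸ k) ! * (i ∸ m ∸ k) !) ≡ i !
      rhs≡i! = begin
        ((i ∸ k) C k) * ((i ∸ 2 * k) C (m ∸ k)) * (i P k) * k ! * ((m ∸ k) ! * (i ∸ m ∸ k) !)
          ≡⟨ solve 6 (λ a b c d e f → a :* b :* c :* d :* (e :* f) := c :* (a :* (d :* (b :* (e :* f))))) refl
               ((i ∸ k) C k) ((i ∸ 2 * k) C (m ∸ k)) (i P k) (k !) ((m ∸ k) !) ((i ∸ m ∸ k) !) ⟩
        (i P k) * (((i ∸ k) C k) * (k ! * (((i ∸ 2 * k) C (m ∸ k)) * ((m ∸ k) ! * (i ∸ m ∸ k) !))))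
          ≡⟨ cong (λ j → (i P k) * (((i ∸ k) C k) * (k ! * (((i ∸ 2 * k) C (m ∸ k)) * ((m ∸ k) ! * j !)))))
                  i∸m∸k≡i∸2k∸[m∸k] ⟩
        (i P k) * (((i ∸ k) C k) * (k ! * (((i ∸ 2 * k) C (m ∸ k)) * ((m ∸ k) ! * (i ∸ 2 * k ∸ (m ∸ k)) !))))
          ≡⟨ cong (λ j → (i P k) * (((i ∸ k) C k) * (k ! * j))) (nCk*k!*[n∸k]!≡n! m∸k≤i∸2k) ⟩
        (i P k) * (((i ∸ k) C k) * (k ! * (i ∸ 2 * k) !))
          ≡⟨ cong (λ j → (i P k) * (((i ∸ k) C k) * (k ! * j !))) i∸k∸k≡i∸2k ⟨
        (i P k) * (((i ∸ k) C k) * (k ! * (i ∸ k ∸ k) !))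
          ≡⟨ cong ((i P k) *_) (nCk*k!*[n∸k]!≡n! k≤i∸k) ⟩
        (i P k) * (i ∸ k) !
          ≡⟨ nPk*[n∸k]!≡n! (≤-trans k≤m m≤i) ⟩
        i ! ∎

open Halving
open Binomial

module FibonacciLucas (R : RealField) where

  open RealField R
  open Poly R
  open import Level using (0ℓ)
  open import Data.Nat using (zero; suc)
  import Data.Nat.Properties as ℕₚ
  open import Data.Nat.Combinatorics using (_P_)
  open import Data.Empty using (⊥-elim)
  open import Data.Maybe using (nothing)
  open import Relation.Nullary using (yes; no)
  open import Relation.Binary.Definitions using (tri<; tri≈; tri>)
  open import Relation.Binary.Structures using (IsStrictTotalOrder)
  open import Relation.Binary.PropositionalEquality
  open import Algebra.Bundles using (CommutativeRing)

  commutativeRing : CommutativeRing 0ℓ 0ℓ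
  commutativeRing = record { isCommutativeRing = isCommutativeRing }

  open CommutativeRing commutativeRing
    using ( +-comm; +-assoc; *-comm; *-assoc; distribˡ; +-identityˡ; +-identityʳ
          ; *-identityˡ; *-identityʳ; -‿inverseˡ; -‿inverseʳ; zeroˡ; zeroʳ
          ; ring; commutativeSemiring)
  open import Algebra.Properties.Ring ring using (-1*x≈-x; -‿distribˡ-*; -‿distribʳ-*; -‿involutive; -‿+-comm)
  open import Algebra.Solver.Ring.NaturalCoefficients commutativeSemiring (λ _ _ → nothing)
  open IsStrictTotalOrder <-isStrictTotalOrder using (compare; irrefl) renaming (trans to <-trans)
  open ≡-Reasoning

  [-1]*[-1]≡1 : - 1# * - 1# ≡ 1#
  [-1]*[-1]≡1 = trans (-1*x≈-x (- 1#)) (-‿involutive 1#)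

  0<1 : 0# < 1#
  0<1 with compare 0# 1#
  ... | tri< 0<1 _ _ = 0<1
  ... | tri≈ _ 0≡1 _ = ⊥-elim (0≢1 0≡1)
  ... | tri> _ _ 1<0 = ⊥-elim (irrefl refl (<-trans 1<0 0<1′))
    where
      0<-1 : 0# < - 1#
      0<-1 = subst₂ _<_ (-‿inverseʳ 1#) (+-identityˡ (- 1#)) (+-mono-< (- 1#) 1<0)
      0<1′ : 0# < 1#
      0<1′ = subst (0# <_) [-1]*[-1]≡1 (*-pos 0<-1 0<-1)

  0<fromℕ[1+n] : ∀ n → 0# < fromℕ (suc n)
  0<fromℕ[1+n] zero    = subst (0# <_) (sym (+-identityʳ 1#)) 0<1
  0<fromℕ[1+n] (suc n) =
    <-trans 0<1 (subst₂ _<_ (+-identityˡ 1#) (+-comm _ 1#) (+-mono-< 1# (0<fromℕ[1+n] n)))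

  fromℕ-≢0 : ∀ {n} → n ≢ 0 → fromℕ n ≢ 0#
  fromℕ-≢0 {zero}  n≢0 _          = n≢0 refl
  fromℕ-≢0 {suc n} _   fromℕn≡0  = irrefl (sym fromℕn≡0) (0<fromℕ[1+n] n)

  x*y*y⁻¹≡x : ∀ x {y} → y ≢ 0# → x * y * y ⁻¹ ≡ x
  x*y*y⁻¹≡x x {y} y≢0 = begin
    x * y * y ⁻¹   ≡⟨ *-assoc x y (y ⁻¹) ⟩
    x * (y * y ⁻¹) ≡⟨ cong (x *_) (⁻¹-inverse y y≢0) ⟩
    x * 1#         ≡⟨ *-identityʳ x ⟩
    x              ∎

  x/y*y≡x : ∀ x {y} → y ≢ 0# → x / y * y ≡ x
  x/y*y≡x x {y} y≢0 = trans (solve 3 (λ x y y⁻¹ → x :* y⁻¹ :* y := x :* y :* y⁻¹) refl x y (y ⁻¹)) (x*y*y⁻¹≡x x y≢0)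

  *-cancelʳ : ∀ {x w} y → y ≢ 0# → x * y ≡ w * y → x ≡ w
  *-cancelʳ {x} {w} y y≢0 xy≡wy = begin
    x            ≡⟨ x*y*y⁻¹≡x x y≢0 ⟨
    x * y * y ⁻¹ ≡⟨ cong (_* y ⁻¹) xy≡wy ⟩
    w * y * y ⁻¹ ≡⟨ x*y*y⁻¹≡x w y≢0 ⟩
    w            ∎

  *-≢0 : ∀ {x y} → x ≢ 0# → y ≢ 0# → x * y ≢ 0#
  *-≢0 {x} {y} x≢0 y≢0 xy≡0 = x≢0 (*-cancelʳ y y≢0 (trans xy≡0 (sym (zeroˡ y))))

  ^-≢0 : ∀ {x} k → x ≢ 0# → x ^ k ≢ 0#
  ^-≢0 zero    _   1≡0 = 0≢1 (sym 1≡0)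
  ^-≢0 (suc k) x≢0     = *-≢0 x≢0 (^-≢0 k x≢0)

  -1≢0 : - 1# ≢ 0#
  -1≢0 -1≡0 = 0≢1 (sym (begin
    1#          ≡⟨ [-1]*[-1]≡1 ⟨
    - 1# * - 1# ≡⟨ cong (_* - 1#) -1≡0 ⟩
    0# * - 1#   ≡⟨ zeroˡ (- 1#) ⟩
    0#          ∎))

  -0#≡0# : - 0# ≡ 0#
  -0#≡0# = trans (sym (+-identityˡ (- 0#))) (-‿inverseʳ 0#)

  c₀*2≡1 : c 0 * (1# + 1#) ≡ 1#
  c₀*2≡1 = x/y*y≡x 1# 2≢0
    where
      2≢0 : 1# + 1# ≢ 0#
      2≢0 2≡0 = fromℕ-≢0 {2} (λ ()) (trans (cong (1# +_) (+-identityʳ 1#)) 2≡0)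

  fromℕ-homo-+ : ∀ m n → fromℕ (m ℕ.+ n) ≡ fromℕ m + fromℕ n
  fromℕ-homo-+ zero    n = sym (+-identityˡ _)
  fromℕ-homo-+ (suc m) n = trans (cong (1# +_) (fromℕ-homo-+ m n)) (sym (+-assoc _ _ _))

  fromℕ-homo-* : ∀ m n → fromℕ (m ℕ.* n) ≡ fromℕ m * fromℕ n
  fromℕ-homo-* zero    n = sym (zeroˡ _)
  fromℕ-homo-* (suc m) n = begin
    fromℕ (n ℕ.+ m ℕ.* n)       ≡⟨ fromℕ-homo-+ n (m ℕ.* n) ⟩
    fromℕ n + fromℕ (m ℕ.* n)   ≡⟨ cong (fromℕ n +_) (fromℕ-homo-* m n) ⟩
    fromℕ n + fromℕ m * fromℕ n ≡⟨ solve 2 (λ m n → n :+ m :* n := (con 1 :+ m) :* n) refl (fromℕ m) (fromℕ n) ⟩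
    (1# + fromℕ m) * fromℕ n    ∎

  ^-distribˡ-+-* : ∀ x m n → x ^ (m ℕ.+ n) ≡ x ^ m * x ^ n
  ^-distribˡ-+-* x zero    n = sym (*-identityˡ _)
  ^-distribˡ-+-* x (suc m) n = trans (cong (x *_) (^-distribˡ-+-* x m n)) (sym (*-assoc _ _ _))

  ^-distribʳ-* : ∀ x y n → (x * y) ^ n ≡ x ^ n * y ^ n
  ^-distribʳ-* x y zero    = sym (*-identityʳ 1#)
  ^-distribʳ-* x y (suc n) = trans (cong ((x * y) *_) (^-distribʳ-* x y n))
    (solve 4 (λ x y xⁿ yⁿ → (x :* y) :* (xⁿ :* yⁿ) := (x :* xⁿ) :* (y :* yⁿ)) refl x y _ _)

  1^n≡1 : ∀ n → 1# ^ n ≡ 1#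
  1^n≡1 zero    = refl
  1^n≡1 (suc n) = trans (*-identityˡ _) (1^n≡1 n)

  [-1]^n*[-1]^n≡1 : ∀ n → (- 1#) ^ n * (- 1#) ^ n ≡ 1#
  [-1]^n*[-1]^n≡1 n = trans (sym (^-distribʳ-* (- 1#) (- 1#) n)) (trans (cong (_^ n) [-1]*[-1]≡1) (1^n≡1 n))

  [-x]^n≡[-1]^n*x^n : ∀ x n → (- x) ^ n ≡ (- 1#) ^ n * x ^ n
  [-x]^n≡[-1]^n*x^n x n = trans (cong (_^ n) (sym (-1*x≈-x x))) (^-distribʳ-* (- 1#) x n)

  sumTo-cong : ∀ n {f g : ℕ → Carrier} → (∀ k → k ℕ.≤ n → f k ≡ g k) → sumTo n f ≡ sumTo n g
  sumTo-cong zero    f≗g = f≗g 0 ℕ.z≤n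
  sumTo-cong (suc n) f≗g =
    cong₂ _+_ (sumTo-cong n (λ k k≤n → f≗g k (ℕₚ.m≤n⇒m≤1+n k≤n))) (f≗g (suc n) ℕₚ.≤-refl)

  sumTo-distrib-+ : ∀ n (f g : ℕ → Carrier) → sumTo n (λ k → f k + g k) ≡ sumTo n f + sumTo n g
  sumTo-distrib-+ zero    f g = refl
  sumTo-distrib-+ (suc n) f g = trans (cong (_+ (f (suc n) + g (suc n))) (sumTo-distrib-+ n f g))
    (solve 4 (λ a b c d → (a :+ b) :+ (c :+ d) := (a :+ c) :+ (b :+ d)) refl _ _ _ _)

  *-distribˡ-sumTo : ∀ n x (f : ℕ → Carrier) → x * sumTo n f ≡ sumTo n (λ k → x * f k)
  *-distribˡ-sumTo zero    x f = refl
  *-distribˡ-sumTo (suc n) x f = trans (distribˡ x _ _) (cong (_+ x * f (suc n)) (*-distribˡ-sumTo n x f))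

  sumTo-shift : ∀ h {f g : ℕ → Carrier} → f 0 ≡ 0# → (∀ j → j ℕ.< h → f (suc j) ≡ g j) →
                sumTo h f + g h ≡ sumTo h g
  sumTo-shift zero    {g = g} f₀≡0 _  = trans (cong (_+ g 0) f₀≡0) (+-identityˡ (g 0))
  sumTo-shift (suc h) {f} {g} f₀≡0 f∘suc≗g = begin
    sumTo h f + f (suc h) + g (suc h) ≡⟨ cong (λ u → sumTo h f + u + g (suc h)) (f∘suc≗g h ℕₚ.≤-refl) ⟩
    sumTo h f + g h + g (suc h)       ≡⟨ cong (_+ g (suc h)) (sumTo-shift h f₀≡0 (λ j j<h → f∘suc≗g j (ℕₚ.m<n⇒m<1+n j<h))) ⟩
    sumTo h g + g (suc h)             ∎

  sumTo-vanishingTail : ∀ {h} n (f : ℕ → Carrier) → h ℕ.≤ n → (∀ k → h ℕ.< k → f k ≡ 0#) →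
                        sumTo n f ≡ sumTo h f
  sumTo-vanishingTail {h} n f h≤n tail≡0 = extend (ℕₚ.≤⇒≤′ h≤n)
    where
      extend : ∀ {n} → h ℕ.≤′ n → sumTo n f ≡ sumTo h f
      extend ℕ.≤′-refl = refl
      extend {suc n} (ℕ.≤′-step h≤′n) = begin
        sumTo n f + f (suc n) ≡⟨ cong (sumTo n f +_) (tail≡0 (suc n) (ℕ.s≤s (ℕₚ.≤′⇒≤ h≤′n))) ⟩
        sumTo n f + 0#        ≡⟨ +-identityʳ _ ⟩
        sumTo n f             ≡⟨ extend h≤′n ⟩
        sumTo h f             ∎

  sumTo-triangle : ∀ N (f : ℕ → ℕ → Carrier) →
    sumTo N (λ m → sumTo m (f m)) ≡ sumTo N (λ k → sumTo (N ∸ k) (λ j → f (k ℕ.+ j) k))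
  sumTo-triangle zero    f = refl
  sumTo-triangle (suc N) f = begin
    sumTo N (λ m → sumTo m (f m)) + sumTo (suc N) (f (suc N))
      ≡⟨ cong (_+ sumTo (suc N) (f (suc N))) (sumTo-triangle N f) ⟩
    sumTo N (λ k → sumTo (N ∸ k) (g k)) + (sumTo N (f (suc N)) + f (suc N) (suc N))
      ≡⟨ +-assoc _ _ _ ⟨
    sumTo N (λ k → sumTo (N ∸ k) (g k)) + sumTo N (f (suc N)) + f (suc N) (suc N)
      ≡⟨ cong₂ _+_ (sym (sumTo-distrib-+ N _ _)) (sym diagonal) ⟩
    sumTo N (λ k → sumTo (N ∸ k) (g k) + f (suc N) k) + sumTo (suc N ∸ suc N) (g (suc N))
      ≡⟨ cong (_+ sumTo (suc N ∸ suc N) (g (suc N))) (sumTo-cong N (λ k k≤N → sym (row k k≤N))) ⟩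
    sumTo N (λ k → sumTo (suc N ∸ k) (g k)) + sumTo (suc N ∸ suc N) (g (suc N)) ∎
    where
      g : ℕ → ℕ → Carrier
      g k j = f (k ℕ.+ j) k
      diagonal : sumTo (suc N ∸ suc N) (g (suc N)) ≡ f (suc N) (suc N)
      diagonal = trans (cong (λ n → sumTo n (g (suc N))) (ℕₚ.n∸n≡0 N))
                       (cong (λ m → f m (suc N)) (ℕₚ.+-identityʳ (suc N)))
      row : ∀ k → k ℕ.≤ N → sumTo (suc N ∸ k) (g k) ≡ sumTo (N ∸ k) (g k) + f (suc N) k
      row k k≤N = trans (cong (λ n → sumTo n (g k)) (ℕₚ.+-∸-assoc 1 k≤N))
        (cong (λ m → sumTo (N ∸ k) (g k) + f m k) (trans (ℕₚ.+-suc k (N ∸ k)) (cong suc (ℕₚ.m+[n∸m]≡n k≤N))))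

  -- Pochhammer symbols and ₂F₁

  poch-suc′ : ∀ u k → poch u (suc k) ≡ u * poch (u + 1#) k
  poch-suc′ u zero    = trans (*-identityˡ _) (trans (+-identityʳ u) (sym (*-identityʳ u)))
  poch-suc′ u (suc k) = trans (cong (_* (u + fromℕ (suc k))) (poch-suc′ u k))
    (solve 3 (λ u p k → (u :* p) :* (u :+ (con 1 :+ k)) := u :* (p :* ((u :+ con 1) :+ k))) refl
      u (poch (u + 1#) k) (fromℕ k))

  -[1+x]+1≡-x : ∀ x → - (1# + x) + 1# ≡ - x
  -[1+x]+1≡-x x = begin
    - (1# + x) + 1#   ≡⟨ cong (_+ 1#) (-‿+-comm 1# x) ⟨
    - 1# + - x + 1#   ≡⟨ solve 3 (λ a b c → a :+ b :+ c := b :+ (a :+ c)) refl (- 1#) (- x) 1# ⟩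
    - x + (- 1# + 1#) ≡⟨ cong (- x +_) (-‿inverseˡ 1#) ⟩
    - x + 0#          ≡⟨ +-identityʳ _ ⟩
    - x               ∎

  poch[-m]k≡[-1]^k*mPk : ∀ m k → poch (- fromℕ m) k ≡ (- 1#) ^ k * fromℕ (m P k)
  poch[-m]k≡[-1]^k*mPk m       zero    = sym (trans (*-identityˡ _) (+-identityʳ 1#))
  poch[-m]k≡[-1]^k*mPk zero    (suc k) = begin
    poch (- 0#) (suc k)          ≡⟨ poch-suc′ (- 0#) k ⟩
    - 0# * poch (- 0# + 1#) k    ≡⟨ cong (_* poch (- 0# + 1#) k) -0#≡0# ⟩
    0# * poch (- 0# + 1#) k      ≡⟨ zeroˡ _ ⟩
    0#                           ≡⟨ zeroʳ _ ⟨
    (- 1#) ^ suc k * fromℕ 0     ∎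
  poch[-m]k≡[-1]^k*mPk (suc m) (suc k) = begin
    poch (- fromℕ (suc m)) (suc k)
      ≡⟨ poch-suc′ _ k ⟩
    - fromℕ (suc m) * poch (- (1# + fromℕ m) + 1#) k
      ≡⟨ cong (λ u → - fromℕ (suc m) * poch u k) (-[1+x]+1≡-x (fromℕ m)) ⟩
    - fromℕ (suc m) * poch (- fromℕ m) k
      ≡⟨ cong₂ _*_ (sym (-1*x≈-x _)) (poch[-m]k≡[-1]^k*mPk m k) ⟩
    - 1# * fromℕ (suc m) * ((- 1#) ^ k * fromℕ (m P k))
      ≡⟨ solve 4 (λ n m σ p → n :* m :* (σ :* p) := n :* σ :* (m :* p))
           refl (- 1#) (fromℕ (suc m)) ((- 1#) ^ k) (fromℕ (m P k)) ⟩
    (- 1#) ^ suc k * (fromℕ (suc m) * fromℕ (m P k))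
      ≡⟨ cong ((- 1#) ^ suc k *_) (trans (sym (fromℕ-homo-* (suc m) (m P k))) (cong fromℕ (sym ([1+n]P[1+k]≡[1+n]*nPk m k)))) ⟩
    (- 1#) ^ suc k * fromℕ (suc m P suc k) ∎

  fromℕm-fromℕi≡-fromℕ[i∸m] : ∀ {m i} → m ℕ.≤ i → fromℕ m + - fromℕ i ≡ - fromℕ (i ∸ m)
  fromℕm-fromℕi≡-fromℕ[i∸m] {m} {i} m≤i = begin
    fromℕ m + - fromℕ i                      ≡⟨ cong (λ n → fromℕ m + - fromℕ n) (ℕₚ.m+[n∸m]≡n m≤i) ⟨
    fromℕ m + - fromℕ (m ℕ.+ (i ∸ m))        ≡⟨ cong (λ u → fromℕ m + - u) (fromℕ-homo-+ m (i ∸ m)) ⟩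
    fromℕ m + - (fromℕ m + fromℕ (i ∸ m))    ≡⟨ cong (fromℕ m +_) (-‿+-comm _ _) ⟨
    fromℕ m + (- fromℕ m + - fromℕ (i ∸ m))  ≡⟨ +-assoc _ _ _ ⟨
    fromℕ m + - fromℕ m + - fromℕ (i ∸ m)    ≡⟨ cong (_+ - fromℕ (i ∸ m)) (-‿inverseʳ _) ⟩
    0# + - fromℕ (i ∸ m)                     ≡⟨ +-identityˡ _ ⟩
    - fromℕ (i ∸ m)                          ∎

  poch[-m]k*poch[m-i]k≡mPk*[i∸m]Pk : ∀ {m i} k → m ℕ.≤ i →
    poch (- fromℕ m) k * poch (fromℕ m + - fromℕ i) k ≡ fromℕ ((m P k) ℕ.* ((i ∸ m) P k))
  poch[-m]k*poch[m-i]k≡mPk*[i∸m]Pk {m} {i} k m≤i = begin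
    poch (- fromℕ m) k * poch (fromℕ m + - fromℕ i) k
      ≡⟨ cong (λ u → poch (- fromℕ m) k * poch u k) (fromℕm-fromℕi≡-fromℕ[i∸m] m≤i) ⟩
    poch (- fromℕ m) k * poch (- fromℕ (i ∸ m)) k
      ≡⟨ cong₂ _*_ (poch[-m]k≡[-1]^k*mPk m k) (poch[-m]k≡[-1]^k*mPk (i ∸ m) k) ⟩
    σ * fromℕ (m P k) * (σ * fromℕ ((i ∸ m) P k))
      ≡⟨ solve 3 (λ σ p q → σ :* p :* (σ :* q) := σ :* σ :* (p :* q)) refl σ (fromℕ (m P k)) (fromℕ ((i ∸ m) P k)) ⟩
    σ * σ * (fromℕ (m P k) * fromℕ ((i ∸ m) P k))
      ≡⟨ cong₂ _*_ ([-1]^n*[-1]^n≡1 k) (sym (fromℕ-homo-* (m P k) _)) ⟩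
    1# * fromℕ ((m P k) ℕ.* ((i ∸ m) P k))
      ≡⟨ *-identityˡ _ ⟩
    fromℕ ((m P k) ℕ.* ((i ∸ m) P k)) ∎
    where σ = (- 1#) ^ k

  poch[-m]k≢0 : ∀ {m k} → k ℕ.≤ m → poch (- fromℕ m) k ≢ 0#
  poch[-m]k≢0 {m} {k} k≤m = subst (_≢ 0#) (sym (poch[-m]k≡[-1]^k*mPk m k)) (*-≢0 (^-≢0 k -1≢0) (fromℕ-≢0 (nPk≢0 k≤m)))

  x/p*[y/q]*[p*q]≡x*y : ∀ x y {p q} → p ≢ 0# → q ≢ 0# → x / p * (y / q) * (p * q) ≡ x * y
  x/p*[y/q]*[p*q]≡x*y x y {p} {q} p≢0 q≢0 = begin
    x / p * (y / q) * (p * q)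
      ≡⟨ solve 6 (λ x p⁻¹ y q⁻¹ p q → x :* p⁻¹ :* (y :* q⁻¹) :* (p :* q) := x :* p :* p⁻¹ :* (y :* q :* q⁻¹))
           refl x (p ⁻¹) y (q ⁻¹) p q ⟩
    x * p * p ⁻¹ * (y * q * q ⁻¹) ≡⟨ cong₂ _*_ (x*y*y⁻¹≡x x p≢0) (x*y*y⁻¹≡x y q≢0) ⟩
    x * y                       ∎

  iCm*hyp2F1≡sumTo : ∀ {i m} → 2 ℕ.* m ℕ.≤ i → ∀ z →
    fromℕ (i C m) * hyp2F1 m (fromℕ m + - fromℕ i) (- fromℕ i) z
      ≡ sumTo m (λ k → fromℕ (((i ∸ k) C k) ℕ.* ((i ∸ 2 ℕ.* k) C (m ∸ k))) * (- z) ^ k)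
  iCm*hyp2F1≡sumTo {i} {m} 2m≤i z = trans (*-distribˡ-sumTo m _ _) (sumTo-cong m termwise)
    where
      m≤i : m ℕ.≤ i
      m≤i = ℕₚ.≤-trans (ℕₚ.m≤m+n m (m ℕ.+ 0)) 2m≤i

      termwise : ∀ k → k ℕ.≤ m →
        fromℕ (i C m) * ((poch (- fromℕ m) k * poch (fromℕ m + - fromℕ i) k) / poch (- fromℕ i) k
                          * ((z ^ k) / fromℕ (k ℕ.!)))
          ≡ fromℕ (((i ∸ k) C k) ℕ.* ((i ∸ 2 ℕ.* k) C (m ∸ k))) * (- z) ^ k
      termwise k k≤m = *-cancelʳ (Den * K) (*-≢0 (poch[-m]k≢0 (ℕₚ.≤-trans k≤m m≤i)) K≢0) (begin
        fromℕ (i C m) * (Num / Den * (Z / K)) * (Den * K)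
          ≡⟨ lhs-cleared ⟩
        fromℕ ((m P k) ℕ.* ((i ∸ m) P k) ℕ.* (i C m)) * Z
          ≡⟨ cong (λ n → fromℕ n * Z) (mPk*[i∸m]Pk*iCm≡[i∸k]Ck*[i∸2k]C[m∸k]*iPk*k! k≤m 2m≤i) ⟩
        fromℕ (CC ℕ.* (i P k) ℕ.* k ℕ.!) * Z
          ≡⟨ rhs-cleared ⟨
        fromℕ CC * (- z) ^ k * (Den * K) ∎)
        where
          Num Den K Z : Carrier
          Num = poch (- fromℕ m) k * poch (fromℕ m + - fromℕ i) k
          Den = poch (- fromℕ i) k
          K = fromℕ (k ℕ.!)
          Z = z ^ k
          CC : ℕ
          CC = ((i ∸ k) C k) ℕ.* ((i ∸ 2 ℕ.* k) C (m ∸ k))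

          K≢0 : K ≢ 0#
          K≢0 = fromℕ-≢0 (ℕ.≢-nonZero⁻¹ (k ℕ.!) {{ℕₚ._!≢0 k}})

          lhs-cleared : fromℕ (i C m) * (Num / Den * (Z / K)) * (Den * K) ≡ fromℕ ((m P k) ℕ.* ((i ∸ m) P k) ℕ.* (i C m)) * Z
          lhs-cleared = begin
            fromℕ (i C m) * (Num / Den * (Z / K)) * (Den * K)
              ≡⟨ *-assoc _ _ _ ⟩
            fromℕ (i C m) * (Num / Den * (Z / K) * (Den * K))
              ≡⟨ cong (fromℕ (i C m) *_) (x/p*[y/q]*[p*q]≡x*y Num Z (poch[-m]k≢0 (ℕₚ.≤-trans k≤m m≤i)) K≢0) ⟩
            fromℕ (i C m) * (Num * Z)
              ≡⟨ cong (λ u → fromℕ (i C m) * (u * Z)) (poch[-m]k*poch[m-i]k≡mPk*[i∸m]Pk k m≤i) ⟩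
            fromℕ (i C m) * (fromℕ ((m P k) ℕ.* ((i ∸ m) P k)) * Z)
              ≡⟨ solve 3 (λ c q z → c :* (q :* z) := q :* c :* z) refl _ _ Z ⟩
            fromℕ ((m P k) ℕ.* ((i ∸ m) P k)) * fromℕ (i C m) * Z
              ≡⟨ cong (_* Z) (fromℕ-homo-* ((m P k) ℕ.* ((i ∸ m) P k)) (i C m)) ⟨
            fromℕ ((m P k) ℕ.* ((i ∸ m) P k) ℕ.* (i C m)) * Z ∎

          rhs-cleared : fromℕ CC * (- z) ^ k * (Den * K) ≡ fromℕ (CC ℕ.* (i P k) ℕ.* k ℕ.!) * Z
          rhs-cleared = begin
            fromℕ CC * (- z) ^ k * (Den * K)
              ≡⟨ cong₂ (λ u v → fromℕ CC * u * (v * K)) ([-x]^n≡[-1]^n*x^n z k) (poch[-m]k≡[-1]^k*mPk i k) ⟩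
            fromℕ CC * (σ * Z) * (σ * fromℕ (i P k) * K)
              ≡⟨ solve 5 (λ σ c p k z → c :* (σ :* z) :* (σ :* p :* k) := σ :* σ :* (c :* p :* k :* z))
                   refl σ (fromℕ CC) (fromℕ (i P k)) K Z ⟩
            σ * σ * (fromℕ CC * fromℕ (i P k) * K * Z)
              ≡⟨ cong (_* (fromℕ CC * fromℕ (i P k) * K * Z)) ([-1]^n*[-1]^n≡1 k) ⟩
            1# * (fromℕ CC * fromℕ (i P k) * K * Z)
              ≡⟨ *-identityˡ _ ⟩
            fromℕ CC * fromℕ (i P k) * K * Z
              ≡⟨ cong (_* Z) (trans (fromℕ-homo-* (CC ℕ.* (i P k)) (k ℕ.!)) (cong (_* K) (fromℕ-homo-* CC (i P k)))) ⟨
            fromℕ (CC ℕ.* (i P k) ℕ.* k ℕ.!) * Z ∎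
            where
              σ : Carrier
              σ = (- 1#) ^ k

  -- Powers of rx in Lucas polynomials

  module LucasExpansion (r s x : Carrier) where

    y : Carrier
    y = r * x

    ψ₋₁ : ℕ → Carrier
    ψ₋₁ zero    = 0#
    ψ₋₁ (suc d) = ψ r s d x

    -- at d = 0 the factor c₀ = 1/2 compensates ψ₀ = 2
    y*cd*ψd : ∀ d → y * (c d * ψ r s d x) ≡ ψ r s (suc d) x + (- s) * ψ₋₁ d
    y*cd*ψd zero = begin
      y * (c 0 * (1# + 1#)) ≡⟨ cong (y *_) c₀*2≡1 ⟩
      y * 1#                ≡⟨ *-identityʳ y ⟩
      y                     ≡⟨ +-identityʳ y ⟨
      y + 0#                ≡⟨ cong (y +_) (zeroʳ (- s)) ⟨
      y + (- s) * 0#        ∎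
    y*cd*ψd (suc d) = begin
      y * (1# * ψ r s (suc d) x)                ≡⟨ cong (y *_) (*-identityˡ _) ⟩
      y * ψ r s (suc d) x                       ≡⟨ +-identityʳ _ ⟨
      y * ψ r s (suc d) x + 0#                  ≡⟨ cong (y * ψ r s (suc d) x +_) (-‿inverseʳ (s * ψ r s d x)) ⟨
      y * ψ r s (suc d) x + (s * ψ r s d x + - (s * ψ r s d x)) ≡⟨ +-assoc _ _ _ ⟨
      ψ r s (suc (suc d)) x + - (s * ψ r s d x) ≡⟨ cong (ψ r s (suc (suc d)) x +_) (-‿distribˡ-* s _) ⟩
      ψ r s (suc (suc d)) x + (- s) * ψ r s d x ∎

    term : ℕ → ℕ → Carrier
    term n j = c (n ∸ 2 ℕ.* j) * (- s) ^ j * fromℕ (n C j) * ψ r s (n ∸ 2 ℕ.* j) x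

    y*term : ∀ n j → y * term n j ≡
      (- s) ^ j * fromℕ (n C j) * ψ r s (suc (n ∸ 2 ℕ.* j)) x + (- s) ^ suc j * fromℕ (n C j) * ψ₋₁ (n ∸ 2 ℕ.* j)
    y*term n j = begin
      y * (c d * σʲ * Cnj * ψ r s d x)
        ≡⟨ solve 5 (λ y c σʲ C ψ → y :* (c :* σʲ :* C :* ψ) := σʲ :* C :* (y :* (c :* ψ)))
             refl y (c d) σʲ Cnj (ψ r s d x) ⟩
      σʲ * Cnj * (y * (c d * ψ r s d x))
        ≡⟨ cong (σʲ * Cnj *_) (y*cd*ψd d) ⟩
      σʲ * Cnj * (ψ r s (suc d) x + (- s) * ψ₋₁ d)
        ≡⟨ solve 5 (λ σʲ C ψ σ ψ₋ → σʲ :* C :* (ψ :+ σ :* ψ₋) := σʲ :* C :* ψ :+ σ :* σʲ :* C :* ψ₋)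
             refl σʲ Cnj (ψ r s (suc d) x) (- s) (ψ₋₁ d) ⟩
      σʲ * Cnj * ψ r s (suc d) x + (- s) ^ suc j * Cnj * ψ₋₁ d ∎
      where
        d : ℕ
        d = n ∸ 2 ℕ.* j
        σʲ Cnj : Carrier
        σʲ = (- s) ^ j
        Cnj = fromℕ (n C j)

    term[1+n] : ∀ n j → 2 ℕ.* j ℕ.≤ n → term (suc n) j ≡
      (- s) ^ j * fromℕ (n C j) * ψ r s (suc (n ∸ 2 ℕ.* j)) x + (- s) ^ j * fromℕ (n C[ j -1]) * ψ r s (suc (n ∸ 2 ℕ.* j)) x
    term[1+n] n j 2j≤n = begin
      c (suc n ∸ 2 ℕ.* j) * σʲ * fromℕ (suc n C j) * ψ r s (suc n ∸ 2 ℕ.* j) x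
        ≡⟨ cong (λ d → c d * σʲ * fromℕ (suc n C j) * ψ r s d x) (ℕₚ.+-∸-assoc 1 2j≤n) ⟩
      1# * σʲ * fromℕ (suc n C j) * ψ′
        ≡⟨ cong (λ k → 1# * σʲ * fromℕ k * ψ′) ([1+n]Ck≡nCk+nC[k-1] n j) ⟩
      1# * σʲ * fromℕ (n C j ℕ.+ n C[ j -1]) * ψ′
        ≡⟨ cong (λ u → 1# * σʲ * u * ψ′) (fromℕ-homo-+ (n C j) (n C[ j -1])) ⟩
      1# * σʲ * (fromℕ (n C j) + fromℕ (n C[ j -1])) * ψ′
        ≡⟨ solve 4 (λ σʲ a b ψ → con 1 :* σʲ :* (a :+ b) :* ψ := σʲ :* a :* ψ :+ σʲ :* b :* ψ)
             refl σʲ (fromℕ (n C j)) (fromℕ (n C[ j -1])) ψ′ ⟩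
      σʲ * fromℕ (n C j) * ψ′ + σʲ * fromℕ (n C[ j -1]) * ψ′ ∎
      where
        σʲ ψ′ : Carrier
        σʲ = (- s) ^ j
        ψ′ = ψ r s (suc (n ∸ 2 ℕ.* j)) x

    -- The Pascal split of term (suc n) matches y * term n up to the top ψ₋₁ summand, which vanishes
    -- for even n and, for odd n = 1 + 2h, is the extra top term of the sum for n + 1 = 2 (1 + h).
    y*sumTo-term : ∀ n h → 2 ℕ.* h ℕ.≤ n →
      y * sumTo h (term n) ≡ sumTo h (term (suc n)) + (- s) ^ suc h * fromℕ (n C h) * ψ₋₁ (n ∸ 2 ℕ.* h)
    y*sumTo-term n h 2h≤n = begin
      y * sumTo h (term n)                 ≡⟨ *-distribˡ-sumTo h y (term n) ⟩
      sumTo h (λ j → y * term n j)         ≡⟨ sumTo-cong h (λ j _ → y*term n j) ⟩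
      sumTo h (λ j → A j + B j)            ≡⟨ sumTo-distrib-+ h A B ⟩
      sumTo h A + sumTo h B                ≡⟨ cong (sumTo h A +_) (sumTo-shift h V₀≡0 V∘suc≗B) ⟨
      sumTo h A + (sumTo h V + B h)        ≡⟨ +-assoc _ _ _ ⟨
      sumTo h A + sumTo h V + B h          ≡⟨ cong (_+ B h) (sumTo-distrib-+ h A V) ⟨
      sumTo h (λ j → A j + V j) + B h      ≡⟨ cong (_+ B h) (sumTo-cong h (λ j j≤h → sym (term[1+n] n j (2j≤n j≤h)))) ⟩
      sumTo h (term (suc n)) + B h         ∎
      where
        A B V : ℕ → Carrier
        A j = (- s) ^ j * fromℕ (n C j) * ψ r s (suc (n ∸ 2 ℕ.* j)) x
        B j = (- s) ^ suc j * fromℕ (n C j) * ψ₋₁ (n ∸ 2 ℕ.* j)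
        V j = (- s) ^ j * fromℕ (n C[ j -1]) * ψ r s (suc (n ∸ 2 ℕ.* j)) x

        2j≤n : ∀ {j} → j ℕ.≤ h → 2 ℕ.* j ℕ.≤ n
        2j≤n j≤h = ℕₚ.≤-trans (ℕₚ.*-monoʳ-≤ 2 j≤h) 2h≤n

        V₀≡0 : V 0 ≡ 0#
        V₀≡0 = trans (cong (_* ψ r s (suc n) x) (zeroʳ (1#))) (zeroˡ _)

        V∘suc≗B : ∀ j → j ℕ.< h → V (suc j) ≡ B j
        V∘suc≗B j j<h = cong (λ d → (- s) ^ suc j * fromℕ (n C j) * ψ₋₁ d) (sym n∸2j≡2+[n∸2[1+j]])
          where
            2+2j≤n : 2 ℕ.+ 2 ℕ.* j ℕ.≤ n
            2+2j≤n = subst (ℕ._≤ n) (ℕₚ.*-suc 2 j) (2j≤n j<h)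
            n∸2j≡2+[n∸2[1+j]] : n ∸ 2 ℕ.* j ≡ suc (suc (n ∸ 2 ℕ.* suc j))
            n∸2j≡2+[n∸2[1+j]] = begin
              n ∸ 2 ℕ.* j                           ≡⟨ ℕₚ.m+[n∸m]≡n (ℕₚ.m+n≤o⇒m≤o∸n 2 2+2j≤n) ⟨
              2 ℕ.+ (n ∸ 2 ℕ.* j ∸ 2)               ≡⟨ cong (2 ℕ.+_) (ℕₚ.∸-+-assoc n (2 ℕ.* j) 2) ⟩
              2 ℕ.+ (n ∸ (2 ℕ.* j ℕ.+ 2))           ≡⟨ cong (λ k → 2 ℕ.+ (n ∸ k)) (ℕₚ.+-comm (2 ℕ.* j) 2) ⟩
              2 ℕ.+ (n ∸ (2 ℕ.+ 2 ℕ.* j))           ≡⟨ cong (λ k → 2 ℕ.+ (n ∸ k)) (ℕₚ.*-suc 2 j) ⟨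
              2 ℕ.+ (n ∸ 2 ℕ.* suc j)               ∎

    term[2+2h][1+h] : ∀ h → term (suc (suc (2 ℕ.* h))) (suc h) ≡ (- s) ^ suc h * fromℕ (suc (2 ℕ.* h) C h) * ψ₋₁ 1
    term[2+2h][1+h] h = begin
      c (2+2h ∸ 2 ℕ.* suc h) * σ * fromℕ (2+2h C suc h) * ψ r s (2+2h ∸ 2 ℕ.* suc h) x
        ≡⟨ cong (λ d → c d * σ * fromℕ (2+2h C suc h) * ψ r s d x) 2+2h∸2[1+h]≡0 ⟩
      c 0 * σ * fromℕ (2+2h C suc h) * (1# + 1#)
        ≡⟨ cong (λ k → c 0 * σ * fromℕ k * (1# + 1#))
             (trans ([1+n]Ck≡nCk+nC[k-1] (suc (2 ℕ.* h)) (suc h)) (ℕₚ.+-comm _ C₀)) ⟩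
      c 0 * σ * fromℕ (C₀ ℕ.+ suc (2 ℕ.* h) C suc h) * (1# + 1#)
        ≡⟨ cong (λ k → c 0 * σ * fromℕ (C₀ ℕ.+ k) * (1# + 1#)) ([1+2h]C[1+h]≡[1+2h]Ch h) ⟩
      c 0 * σ * fromℕ (C₀ ℕ.+ C₀) * (1# + 1#)
        ≡⟨ cong (λ u → c 0 * σ * u * (1# + 1#)) (fromℕ-homo-+ C₀ C₀) ⟩
      c 0 * σ * (fromℕ C₀ + fromℕ C₀) * (1# + 1#)
        ≡⟨ solve 3 (λ c σ C → c :* σ :* (C :+ C) :* (con 1 :+ con 1) := σ :* C :* (con 1 :+ con 1) :* (c :* (con 1 :+ con 1)))
             refl (c 0) σ (fromℕ C₀) ⟩
      σ * fromℕ C₀ * (1# + 1#) * (c 0 * (1# + 1#))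
        ≡⟨ cong (σ * fromℕ C₀ * (1# + 1#) *_) c₀*2≡1 ⟩
      σ * fromℕ C₀ * (1# + 1#) * 1#
        ≡⟨ *-identityʳ _ ⟩
      σ * fromℕ C₀ * (1# + 1#) ∎
      where
        2+2h C₀ : ℕ
        2+2h = suc (suc (2 ℕ.* h))
        C₀ = suc (2 ℕ.* h) C h
        σ : Carrier
        σ = (- s) ^ suc h
        2+2h∸2[1+h]≡0 : 2+2h ∸ 2 ℕ.* suc h ≡ 0
        2+2h∸2[1+h]≡0 = trans (cong (2+2h ∸_) (ℕₚ.*-suc 2 h)) (ℕₚ.n∸n≡0 (2 ℕ.* h))

    odd-power : ∀ h → y ^ (2 ℕ.* h) ≡ sumTo h (term (2 ℕ.* h)) → y ^ suc (2 ℕ.* h) ≡ sumTo h (term (suc (2 ℕ.* h)))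
    odd-power h y^2h≡ = begin
      y * y ^ (2 ℕ.* h)
        ≡⟨ cong (y *_) y^2h≡ ⟩
      y * sumTo h (term (2 ℕ.* h))
        ≡⟨ y*sumTo-term (2 ℕ.* h) h ℕₚ.≤-refl ⟩
      sumTo h (term (suc (2 ℕ.* h))) + σC * ψ₋₁ (2 ℕ.* h ∸ 2 ℕ.* h)
        ≡⟨ cong (λ d → sumTo h (term (suc (2 ℕ.* h))) + σC * ψ₋₁ d) (ℕₚ.n∸n≡0 (2 ℕ.* h)) ⟩
      sumTo h (term (suc (2 ℕ.* h))) + σC * 0#
        ≡⟨ cong (sumTo h (term (suc (2 ℕ.* h))) +_) (zeroʳ σC) ⟩
      sumTo h (term (suc (2 ℕ.* h))) + 0#
        ≡⟨ +-identityʳ _ ⟩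
      sumTo h (term (suc (2 ℕ.* h))) ∎
      where
        σC : Carrier
        σC = (- s) ^ suc h * fromℕ (2 ℕ.* h C h)

    even-power : ∀ h → y ^ suc (2 ℕ.* h) ≡ sumTo h (term (suc (2 ℕ.* h))) →
                 y ^ (2 ℕ.* suc h) ≡ sumTo (suc h) (term (2 ℕ.* suc h))
    even-power h y^[1+2h]≡ = begin
      y ^ (2 ℕ.* suc h)
        ≡⟨ cong (y ^_) (ℕₚ.*-suc 2 h) ⟩
      y * y ^ suc (2 ℕ.* h)
        ≡⟨ cong (y *_) y^[1+2h]≡ ⟩
      y * sumTo h (term (suc (2 ℕ.* h)))
        ≡⟨ y*sumTo-term (suc (2 ℕ.* h)) h (ℕₚ.n≤1+n _) ⟩
      sumTo h (term 2+2h) + σC * ψ₋₁ (suc (2 ℕ.* h) ∸ 2 ℕ.* h)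
        ≡⟨ cong (λ d → sumTo h (term 2+2h) + σC * ψ₋₁ d) (ℕₚ.m+n∸n≡m 1 (2 ℕ.* h)) ⟩
      sumTo h (term 2+2h) + σC * ψ₋₁ 1
        ≡⟨ cong (sumTo h (term 2+2h) +_) (term[2+2h][1+h] h) ⟨
      sumTo (suc h) (term 2+2h)
        ≡⟨ cong (λ n → sumTo (suc h) (term n)) (ℕₚ.*-suc 2 h) ⟨
      sumTo (suc h) (term (2 ℕ.* suc h)) ∎
      where
        2+2h : ℕ
        2+2h = suc (suc (2 ℕ.* h))
        σC : Carrier
        σC = (- s) ^ suc h * fromℕ (suc (2 ℕ.* h) C h)

    y^2h≡sumTo-term : ∀ h → y ^ (2 ℕ.* h) ≡ sumTo h (term (2 ℕ.* h))
    y^2h≡sumTo-term zero    = sym (trans (cong (λ u → c 0 * 1# * u * (1# + 1#)) (+-identityʳ 1#))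
      (trans (solve 1 (λ c → c :* con 1 :* con 1 :* (con 1 :+ con 1) := c :* (con 1 :+ con 1)) refl (c 0)) c₀*2≡1))
    y^2h≡sumTo-term (suc h) = even-power h (odd-power h (y^2h≡sumTo-term h))

    y^n≡sumTo-term : ∀ {n h} → FloorHalf n h → y ^ n ≡ sumTo h (term n)
    y^n≡sumTo-term (even h) = y^2h≡sumTo-term h
    y^n≡sumTo-term (odd h)  = odd-power h (y^2h≡sumTo-term h)

  -- Fibonacci polynomials

  fibTerm : Carrier → Carrier → ℕ → ℕ → Carrier
  fibTerm b t n k = fromℕ ((n ∸ k) C k) * b ^ k * t ^ (n ∸ 2 ℕ.* k)

  N≡0⇒fromℕN*u*v≡0 : ∀ {N} u v → N ≡ 0 → fromℕ N * u * v ≡ 0#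
  N≡0⇒fromℕN*u*v≡0 u v refl = trans (cong (_* v) (zeroˡ u)) (zeroˡ v)

  fibTerm≡0 : ∀ b t {n} k → n ℕ.< 2 ℕ.* k → fibTerm b t n k ≡ 0#
  fibTerm≡0 b t {n} k n<2k = N≡0⇒fromℕN*u*v≡0 (b ^ k) (t ^ (n ∸ 2 ℕ.* k)) (n<2k⇒[n∸k]Ck≡0 k n<2k)

  sumTo-fibTerm-rec : ∀ b t n → sumTo (suc n) (fibTerm b t (suc (suc n)))
                              ≡ t * sumTo (suc n) (fibTerm b t (suc n)) + b * sumTo n (fibTerm b t n)
  sumTo-fibTerm-rec b t n = begin
    sumTo (suc n) (fibTerm b t (suc (suc n)))
      ≡⟨ sumTo-cong (suc n) pascal ⟩
    sumTo (suc n) (λ k → G k + H k)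
      ≡⟨ sumTo-distrib-+ (suc n) G H ⟩
    sumTo (suc n) G + (sumTo n H + H (suc n))
      ≡⟨ cong₂ (λ u v → u + (sumTo n H + v)) (sumTo-cong (suc n) (λ k _ → sym (t*fibTerm≡G k))) (H∘suc≗b*fibTerm n) ⟩
    sumTo (suc n) (λ k → t * fibTerm b t (suc n) k) + (sumTo n H + b * fibTerm b t n n)
      ≡⟨ cong₂ _+_ (sym (*-distribˡ-sumTo (suc n) t _))
                   (sumTo-shift n (N≡0⇒fromℕN*u*v≡0 _ _ refl) (λ j _ → H∘suc≗b*fibTerm j)) ⟩
    t * sumTo (suc n) (fibTerm b t (suc n)) + sumTo n (λ k → b * fibTerm b t n k)
      ≡⟨ cong (t * sumTo (suc n) (fibTerm b t (suc n)) +_) (sym (*-distribˡ-sumTo n b _)) ⟩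
    t * sumTo (suc n) (fibTerm b t (suc n)) + b * sumTo n (fibTerm b t n) ∎
    where
      G H : ℕ → Carrier
      G k = fromℕ ((suc n ∸ k) C k) * b ^ k * t ^ (suc (suc n) ∸ 2 ℕ.* k)
      H k = fromℕ ((suc n ∸ k) C[ k -1]) * b ^ k * t ^ (suc (suc n) ∸ 2 ℕ.* k)

      pascal : ∀ k → k ℕ.≤ suc n → fibTerm b t (suc (suc n)) k ≡ G k + H k
      pascal k k≤1+n = begin
        fromℕ ((suc (suc n) ∸ k) C k) * b ^ k * tᵉ
          ≡⟨ cong (λ m → fromℕ (m C k) * b ^ k * tᵉ) (ℕₚ.+-∸-assoc 1 k≤1+n) ⟩
        fromℕ (suc (suc n ∸ k) C k) * b ^ k * tᵉ
          ≡⟨ cong (λ m → fromℕ m * b ^ k * tᵉ) ([1+n]Ck≡nCk+nC[k-1] (suc n ∸ k) k) ⟩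
        fromℕ ((suc n ∸ k) C k ℕ.+ (suc n ∸ k) C[ k -1]) * b ^ k * tᵉ
          ≡⟨ cong (λ u → u * b ^ k * tᵉ) (fromℕ-homo-+ ((suc n ∸ k) C k) ((suc n ∸ k) C[ k -1])) ⟩
        (fromℕ ((suc n ∸ k) C k) + fromℕ ((suc n ∸ k) C[ k -1])) * b ^ k * tᵉ
          ≡⟨ solve 4 (λ u v w z → (u :+ v) :* w :* z := u :* w :* z :+ v :* w :* z) refl _ _ (b ^ k) tᵉ ⟩
        G k + H k ∎
        where
          tᵉ : Carrier
          tᵉ = t ^ (suc (suc n) ∸ 2 ℕ.* k)

      t*fibTerm≡G : ∀ k → t * fibTerm b t (suc n) k ≡ G k
      t*fibTerm≡G k with 2 ℕ.* k ℕ.≤? suc n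
      ... | yes 2k≤1+n = begin
        t * (fromℕ ((suc n ∸ k) C k) * b ^ k * t ^ (suc n ∸ 2 ℕ.* k))
          ≡⟨ solve 4 (λ t u v w → t :* (u :* v :* w) := u :* v :* (t :* w)) refl t _ (b ^ k) _ ⟩
        fromℕ ((suc n ∸ k) C k) * b ^ k * t ^ suc (suc n ∸ 2 ℕ.* k)
          ≡⟨ cong (λ e → fromℕ ((suc n ∸ k) C k) * b ^ k * t ^ e) (ℕₚ.+-∸-assoc 1 2k≤1+n) ⟨
        G k ∎
      ... | no 2k≰1+n = begin
        t * fibTerm b t (suc n) k ≡⟨ cong (t *_) (fibTerm≡0 b t k 1+n<2k) ⟩
        t * 0#                    ≡⟨ zeroʳ t ⟩
        0#                        ≡⟨ N≡0⇒fromℕN*u*v≡0 _ _ (n<2k⇒[n∸k]Ck≡0 k 1+n<2k) ⟨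
        G k                       ∎
        where
          1+n<2k : suc n ℕ.< 2 ℕ.* k
          1+n<2k = ℕₚ.≰⇒> 2k≰1+n

      H∘suc≗b*fibTerm : ∀ j → H (suc j) ≡ b * fibTerm b t n j
      H∘suc≗b*fibTerm j = begin
        fromℕ ((n ∸ j) C j) * (b * b ^ j) * t ^ (suc (suc n) ∸ 2 ℕ.* suc j)
          ≡⟨ cong (λ e → fromℕ ((n ∸ j) C j) * (b * b ^ j) * t ^ (suc (suc n) ∸ e)) (ℕₚ.*-suc 2 j) ⟩
        fromℕ ((n ∸ j) C j) * (b * b ^ j) * t ^ (n ∸ 2 ℕ.* j)
          ≡⟨ solve 4 (λ u b v w → u :* (b :* v) :* w := b :* (u :* v :* w)) refl _ b (b ^ j) _ ⟩
        b * fibTerm b t n j ∎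

  φ≡sumTo-fibTerm : ∀ a b x n → φ a b n x ≡ sumTo n (fibTerm b (a * x) n)
  φ≡sumTo-fibTerm a b x zero = begin
    1#                  ≡⟨ *-identityʳ 1# ⟨
    1# * 1#             ≡⟨ *-identityʳ (1# * 1#) ⟨
    1# * 1# * 1#        ≡⟨ cong (λ u → u * 1# * 1#) (+-identityʳ 1#) ⟨
    (1# + 0#) * 1# * 1# ∎
  φ≡sumTo-fibTerm a b x (suc zero) = sym (begin
    (1# + 0#) * 1# * (a * x * 1#) + fromℕ 0 * (b * 1#) * 1#
      ≡⟨ cong₂ _+_ (cong (λ u → u * 1# * (a * x * 1#)) (+-identityʳ 1#)) (N≡0⇒fromℕN*u*v≡0 (b * 1#) 1# refl) ⟩
    1# * 1# * (a * x * 1#) + 0#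
      ≡⟨ solve 1 (λ t → con 1 :* con 1 :* (t :* con 1) :+ con 0 := t) refl (a * x) ⟩
    a * x ∎)
  φ≡sumTo-fibTerm a b x (suc (suc n)) = begin
    t * φ a b (suc n) x + b * φ a b n x
      ≡⟨ cong₂ (λ u v → t * u + b * v) (φ≡sumTo-fibTerm a b x (suc n)) (φ≡sumTo-fibTerm a b x n) ⟩
    t * sumTo (suc n) (fibTerm b t (suc n)) + b * sumTo n (fibTerm b t n)
      ≡⟨ sumTo-fibTerm-rec b t n ⟨
    sumTo (suc n) (fibTerm b t (suc (suc n)))
      ≡⟨ sumTo-vanishingTail (suc (suc n)) _ (ℕₚ.n≤1+n _) (λ k 1+n<k → fibTerm≡0 b t k (2+n<2k 1+n<k)) ⟨
    sumTo (suc (suc n)) (fibTerm b t (suc (suc n))) ∎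
    where
      t : Carrier
      t = a * x
      2+n<2k : ∀ {k} → suc n ℕ.< k → suc (suc n) ℕ.< 2 ℕ.* k
      2+n<2k 1+n<k = ℕₚ.<-≤-trans (ℕₚ.m<m+n (suc (suc n)) ℕₚ.0<1+n) (ℕₚ.*-monoʳ-≤ 2 1+n<k)

  φ≡sumTo-fibTerm-floorHalf : ∀ a b x {n h} → FloorHalf n h → φ a b n x ≡ sumTo h (fibTerm b (a * x) n)
  φ≡sumTo-fibTerm-floorHalf a b x {n} half =
    trans (φ≡sumTo-fibTerm a b x n)
          (sumTo-vanishingTail n _ (floorHalf⇒h≤n half) (λ k h<k → fibTerm≡0 b (a * x) k (floorHalf⇒n<2k half h<k)))

  [α*α]^k≡α^[2k] : ∀ α k → (α * α) ^ k ≡ α ^ (2 ℕ.* k)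
  [α*α]^k≡α^[2k] α k = begin
    (α * α) ^ k       ≡⟨ ^-distribʳ-* α α k ⟩
    α ^ k * α ^ k     ≡⟨ ^-distribˡ-+-* α k k ⟨
    α ^ (k ℕ.+ k)     ≡⟨ cong (λ m → α ^ (k ℕ.+ m)) (ℕₚ.+-identityʳ k) ⟨
    α ^ (2 ℕ.* k)     ∎

  fibTerm-rescale : ∀ α b t {n k} → 2 ℕ.* k ℕ.≤ n → fibTerm (α * α * b) (α * t) n k ≡ α ^ n * fibTerm b t n k
  fibTerm-rescale α b t {n} {k} 2k≤n = begin
    Cₖ * (α * α * b) ^ k * (α * t) ^ e
      ≡⟨ cong₂ (λ u v → Cₖ * u * v) (^-distribʳ-* (α * α) b k) (^-distribʳ-* α t e) ⟩
    Cₖ * ((α * α) ^ k * b ^ k) * (α ^ e * t ^ e)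
      ≡⟨ cong (λ u → Cₖ * (u * b ^ k) * (α ^ e * t ^ e)) ([α*α]^k≡α^[2k] α k) ⟩
    Cₖ * (α ^ (2 ℕ.* k) * b ^ k) * (α ^ e * t ^ e)
      ≡⟨ solve 5 (λ C α₁ bᵏ α₂ tᵉ → C :* (α₁ :* bᵏ) :* (α₂ :* tᵉ) := α₁ :* α₂ :* (C :* bᵏ :* tᵉ))
           refl Cₖ (α ^ (2 ℕ.* k)) (b ^ k) (α ^ e) (t ^ e) ⟩
    α ^ (2 ℕ.* k) * α ^ e * fibTerm b t n k
      ≡⟨ cong (_* fibTerm b t n k) (sym (^-distribˡ-+-* α (2 ℕ.* k) e)) ⟩
    α ^ (2 ℕ.* k ℕ.+ e) * fibTerm b t n k
      ≡⟨ cong (λ m → α ^ m * fibTerm b t n k) (ℕₚ.m+[n∸m]≡n 2k≤n) ⟩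
    α ^ n * fibTerm b t n k ∎
    where
      Cₖ : Carrier
      Cₖ = fromℕ ((n ∸ k) C k)
      e : ℕ
      e = n ∸ 2 ℕ.* k

  sumTo-fibTerm-rescale : ∀ α b t {n h} → 2 ℕ.* h ℕ.≤ n →
    sumTo h (fibTerm (α * α * b) (α * t) n) ≡ α ^ n * sumTo h (fibTerm b t n)
  sumTo-fibTerm-rescale α b t {n} {h} 2h≤n = begin
    sumTo h (fibTerm (α * α * b) (α * t) n)
      ≡⟨ sumTo-cong h (λ k k≤h → fibTerm-rescale α b t {k = k} (ℕₚ.≤-trans (ℕₚ.*-monoʳ-≤ 2 k≤h) 2h≤n)) ⟩
    sumTo h (λ k → α ^ n * fibTerm b t n k)      ≡⟨ *-distribˡ-sumTo h (α ^ n) (fibTerm b t n) ⟨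
    α ^ n * sumTo h (fibTerm b t n)             ∎

  -- Re-expanding the Fibonacci sum

  sumTo-fibTerm≡sumTo-hyp2F1 : ∀ r s x z {i H} → FloorHalf i H →
    sumTo H (fibTerm ((- s) * (- z)) (r * x) i)
      ≡ sumTo H (λ m → c (i ∸ 2 ℕ.* m) * ((- s) ^ m) * fromℕ (i C m)
                         * hyp2F1 m (fromℕ m + - fromℕ i) (- fromℕ i) z * ψ r s (i ∸ 2 ℕ.* m) x)
  sumTo-fibTerm≡sumTo-hyp2F1 r s x z {i} {H} half = begin
    sumTo H (fibTerm ((- s) * (- z)) y i)                ≡⟨ sumTo-cong H expand ⟩
    sumTo H (λ k → sumTo (H ∸ k) (λ j → U (k ℕ.+ j) k))  ≡⟨ sumTo-triangle H U ⟨
    sumTo H (λ m → sumTo m (U m))                         ≡⟨ sumTo-cong H collect ⟩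
    sumTo H _                                             ∎
    where
      open LucasExpansion r s x

      2m≤i : ∀ {m} → m ℕ.≤ H → 2 ℕ.* m ℕ.≤ i
      2m≤i m≤H = ℕₚ.≤-trans (ℕₚ.*-monoʳ-≤ 2 m≤H) (floorHalf⇒2h≤n half)

      U : ℕ → ℕ → Carrier
      U m k = c (i ∸ 2 ℕ.* m) * (- s) ^ m * ψ r s (i ∸ 2 ℕ.* m) x
              * (fromℕ (((i ∸ k) C k) ℕ.* ((i ∸ 2 ℕ.* k) C (m ∸ k))) * (- z) ^ k)

      product : ∀ k j → fromℕ ((i ∸ k) C k) * ((- s) * (- z)) ^ k * term (i ∸ 2 ℕ.* k) j ≡ U (k ℕ.+ j) k
      product k j = begin
        Cₖ * ((- s) * (- z)) ^ k * (c d * (- s) ^ j * Cⱼ * ψ r s d x)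
          ≡⟨ cong (λ u → Cₖ * u * (c d * (- s) ^ j * Cⱼ * ψ r s d x)) (^-distribʳ-* (- s) (- z) k) ⟩
        Cₖ * ((- s) ^ k * (- z) ^ k) * (c d * (- s) ^ j * Cⱼ * ψ r s d x)
          ≡⟨ solve 7 (λ Cₖ σᵏ ζᵏ c σʲ Cⱼ ψ →
                        Cₖ :* (σᵏ :* ζᵏ) :* (c :* σʲ :* Cⱼ :* ψ) := c :* (σᵏ :* σʲ) :* ψ :* (Cₖ :* Cⱼ :* ζᵏ))
               refl Cₖ ((- s) ^ k) ((- z) ^ k) (c d) ((- s) ^ j) Cⱼ (ψ r s d x) ⟩
        c d * ((- s) ^ k * (- s) ^ j) * ψ r s d x * (Cₖ * Cⱼ * (- z) ^ k)
          ≡⟨ cong₂ (λ u v → c d * u * ψ r s d x * (v * (- z) ^ k))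
               (sym (^-distribˡ-+-* (- s) k j)) (sym (fromℕ-homo-* ((i ∸ k) C k) ((i ∸ 2 ℕ.* k) C j))) ⟩
        c d * (- s) ^ (k ℕ.+ j) * ψ r s d x * (fromℕ (((i ∸ k) C k) ℕ.* ((i ∸ 2 ℕ.* k) C j)) * (- z) ^ k)
          ≡⟨ cong₂ (λ d′ j′ → c d′ * (- s) ^ (k ℕ.+ j) * ψ r s d′ x
                                * (fromℕ (((i ∸ k) C k) ℕ.* ((i ∸ 2 ℕ.* k) C j′)) * (- z) ^ k))
               i∸2k∸2j≡i∸2[k+j] (sym (ℕₚ.m+n∸m≡n k j)) ⟩
        U (k ℕ.+ j) k ∎
        where
          d : ℕ
          d = i ∸ 2 ℕ.* k ∸ 2 ℕ.* j
          Cₖ Cⱼ : Carrier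
          Cₖ = fromℕ ((i ∸ k) C k)
          Cⱼ = fromℕ ((i ∸ 2 ℕ.* k) C j)
          i∸2k∸2j≡i∸2[k+j] : i ∸ 2 ℕ.* k ∸ 2 ℕ.* j ≡ i ∸ 2 ℕ.* (k ℕ.+ j)
          i∸2k∸2j≡i∸2[k+j] = trans (ℕₚ.∸-+-assoc i (2 ℕ.* k) (2 ℕ.* j)) (cong (i ∸_) (sym (ℕₚ.*-distribˡ-+ 2 k j)))

      expand : ∀ k → k ℕ.≤ H → fibTerm ((- s) * (- z)) y i k ≡ sumTo (H ∸ k) (λ j → U (k ℕ.+ j) k)
      expand k k≤H = begin
        fromℕ ((i ∸ k) C k) * ((- s) * (- z)) ^ k * y ^ (i ∸ 2 ℕ.* k)
          ≡⟨ cong (fromℕ ((i ∸ k) C k) * ((- s) * (- z)) ^ k *_) (y^n≡sumTo-term (floorHalf-∸ k k≤H half)) ⟩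
        fromℕ ((i ∸ k) C k) * ((- s) * (- z)) ^ k * sumTo (H ∸ k) (term (i ∸ 2 ℕ.* k))
          ≡⟨ *-distribˡ-sumTo (H ∸ k) _ _ ⟩
        sumTo (H ∸ k) (λ j → fromℕ ((i ∸ k) C k) * ((- s) * (- z)) ^ k * term (i ∸ 2 ℕ.* k) j)
          ≡⟨ sumTo-cong (H ∸ k) (λ j _ → product k j) ⟩
        sumTo (H ∸ k) (λ j → U (k ℕ.+ j) k) ∎

      collect : ∀ m → m ℕ.≤ H → sumTo m (U m) ≡ c (i ∸ 2 ℕ.* m) * ((- s) ^ m) * fromℕ (i C m)
                                  * hyp2F1 m (fromℕ m + - fromℕ i) (- fromℕ i) z * ψ r s (i ∸ 2 ℕ.* m) x
      collect m m≤H = begin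
        sumTo m (U m)                   ≡⟨ *-distribˡ-sumTo m (cₘ * σᵐ * ψₘ) _ ⟨
        cₘ * σᵐ * ψₘ * sumTo m (λ k → fromℕ (((i ∸ k) C k) ℕ.* ((i ∸ 2 ℕ.* k) C (m ∸ k))) * (- z) ^ k)
                                        ≡⟨ cong (cₘ * σᵐ * ψₘ *_) (iCm*hyp2F1≡sumTo {i} {m} (2m≤i m≤H) z) ⟨
        cₘ * σᵐ * ψₘ * (Cᵢₘ * F)        ≡⟨ solve 5 (λ c σ ψ C F → c :* σ :* ψ :* (C :* F) := c :* σ :* C :* F :* ψ)
                                             refl cₘ σᵐ ψₘ Cᵢₘ F ⟩
        cₘ * σᵐ * Cᵢₘ * F * ψₘ          ∎
        where
          cₘ σᵐ ψₘ Cᵢₘ F : Carrier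
          cₘ  = c (i ∸ 2 ℕ.* m)
          σᵐ  = (- s) ^ m
          ψₘ  = ψ r s (i ∸ 2 ℕ.* m) x
          Cᵢₘ = fromℕ (i C m)
          F   = hyp2F1 m (fromℕ m + - fromℕ i) (- fromℕ i) z

  x/r*[r*y]≡x*y : ∀ x y {r} → r ≢ 0# → x / r * (r * y) ≡ x * y
  x/r*[r*y]≡x*y x y {r} r≢0 = begin
    x / r * (r * y)  ≡⟨ solve 4 (λ x r⁻¹ r y → x :* r⁻¹ :* (r :* y) := x :* r :* r⁻¹ :* y) refl x (r ⁻¹) r y ⟩
    x * r * r ⁻¹ * y ≡⟨ cong (_* y) (x*y*y⁻¹≡x x r≢0) ⟩
    x * y            ∎

  -x*-y≡x*y : ∀ x y → (- x) * (- y) ≡ x * y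
  -x*-y≡x*y x y = begin
    (- x) * (- y)   ≡⟨ -‿distribˡ-* x (- y) ⟨
    - (x * - y)     ≡⟨ cong -_ (-‿distribʳ-* x y) ⟨
    - (- (x * y))   ≡⟨ -‿involutive (x * y) ⟩
    x * y           ∎

  [a/r]²*[-s]*[-z]≡b : ∀ a b {r s} → a ≢ 0# → r ≢ 0# → s ≢ 0# →
    a / r * (a / r) * ((- s) * (- ((b * (r * r)) / ((a * a) * s)))) ≡ b
  [a/r]²*[-s]*[-z]≡b a b {r} {s} a≢0 r≢0 s≢0 = begin
    a / r * (a / r) * ((- s) * (- (N / D)))
      ≡⟨ cong (a / r * (a / r) *_) (-x*-y≡x*y s (N / D)) ⟩
    a / r * (a / r) * (s * (N / D))
      ≡⟨ solve 6 (λ a r⁻¹ s N D⁻¹ r → a :* r⁻¹ :* (a :* r⁻¹) :* (s :* (N :* D⁻¹)) := N :* D⁻¹ :* (a :* a :* s) :* r⁻¹ :* r⁻¹)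
           refl a (r ⁻¹) s N (D ⁻¹) r ⟩
    N / D * D * r ⁻¹ * r ⁻¹
      ≡⟨ cong (λ u → u * r ⁻¹ * r ⁻¹) (x/y*y≡x N (*-≢0 (*-≢0 a≢0 a≢0) s≢0)) ⟩
    b * (r * r) * r ⁻¹ * r ⁻¹
      ≡⟨ cong (λ u → u * r ⁻¹ * r ⁻¹) (*-assoc b r r) ⟨
    b * r * r * r ⁻¹ * r ⁻¹
      ≡⟨ cong (_* r ⁻¹) (x*y*y⁻¹≡x (b * r) r≢0) ⟩
    b * r * r ⁻¹
      ≡⟨ x*y*y⁻¹≡x b r≢0 ⟩
    b ∎
    where
      N D : Carrier
      N = b * (r * r)
      D = (a * a) * s

theorem1 : (R : RealField) →
    let open RealField R
        open Poly R
    in (a b r s : Carrier) → a ≢ 0# → b ≢ 0# → r ≢ 0# → s ≢ 0# →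
       (i : ℕ) (x : Carrier) →
       φ a b i x ≡
         ((a / r) ^ i) *
           sumTo (i ℕ./ 2) (λ m →
             c (i ∸ 2 ℕ.* m) * ((- s) ^ m) * fromℕ (i C m)
               * hyp2F1 m (fromℕ m + - fromℕ i) (- fromℕ i)
                   ((b * (r * r)) / ((a * a) * s))
               * ψ r s (i ∸ 2 ℕ.* m) x)
theorem1 R a b r s a≢0 _ r≢0 s≢0 i x = begin
  φ a b i x                                        ≡⟨ φ≡sumTo-fibTerm-floorHalf a b x half ⟩
  sumTo H (fibTerm b (a * x) i)                    ≡⟨ cong₂ (λ b′ t → sumTo H (fibTerm b′ t i)) b≡α²w ax≡αy ⟩
  sumTo H (fibTerm (α * α * w) (α * (r * x)) i)    ≡⟨ sumTo-fibTerm-rescale α w (r * x) {h = H} (floorHalf⇒2h≤n half) ⟩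
  α ^ i * sumTo H (fibTerm w (r * x) i)            ≡⟨ cong (α ^ i *_) (sumTo-fibTerm≡sumTo-hyp2F1 r s x z half) ⟩
  α ^ i * sumTo H _                                ∎
  where
    open RealField R
    open Poly R
    open FibonacciLucas R
    open ≡-Reasoning
    H : ℕ
    H = i ℕ./ 2
    half : FloorHalf i H
    half = floorHalf-/2 i
    α z w : Carrier
    α = a / r
    z = (b * (r * r)) / ((a * a) * s)
    w = (- s) * (- z)
    b≡α²w : b ≡ α * α * w
    b≡α²w = sym ([a/r]²*[-s]*[-z]≡b a b a≢0 r≢0 s≢0)
    ax≡αy : a * x ≡ α * (r * x)
    ax≡αy = sym (x/r*[r*y]≡x*y a x r≢0)
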